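{- Let $w_1,w_2$ be positive integers and $n\ge0$ an integer. Then $$\sum_{k=0}^n\binom{n}{k}S_{k,q^{w_1}}(w_2-1)S_{n-k,q}(w_1-1)\,w_1^k=\sum_{k=0}^n\binom{n}{k}S_{k,q^{w_2}}(w_1-1)S_{n-k,q}(w_2-1)\,w_2^k.$$
   Context: Let $p$ be a prime, $\mathbb{C}_p$ the completion of an algebraic closure of $\mathbb{Q}_p$, and $|\cdot|_p$ the absolute value on $\mathbb{C}_p$ with $|p|_p=1/p$. Fix $q\in\mathbb{C}_p$ with $q\neq 1$ and $|q-1|_p<p^{ -1/(p-1)}$. For $Q\in\mathbb{C}_p$ and integers $k\ge0$, $N\ge0$, the $Q$-analogue of the power sum is $S_{k,Q}(N)=\sum_{i=0}^N i^kQ^i$, with the convention $0^0=1$. -}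

module Defs where

open import Level using (Level)
open import Data.Nat using (ℕ; zero; suc)
open import Algebra.Bundles using (CommutativeRing; Semiring)
import Algebra.Definitions.RawSemiring as RS

module QPower {c ℓ : Level} (R : CommutativeRing c ℓ) where
  open CommutativeRing R
  open RS (Semiring.rawSemiring semiring) public using (_×_; _^_)

  ⟦_⟧ : ℕ → Carrier
  ⟦ n ⟧ = n × 1#

  sumTo : ℕ → (ℕ → Carrier) → Carrier
  sumTo zero    f = f 0
  sumTo (suc N) f = sumTo N f + f (suc N)

  -- S_{k,Q}(N) = Σ_{i=0}^{N} i^k Q^i   (0^0 = 1, since x ^ 0 = 1#)
  S : ℕ → Carrier → ℕ → Carrier
  S k Q N = sumTo N (λ i → (⟦ i ⟧ ^ k) * (Q ^ i))

module Submission where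

-- Write a = w₁, b = w₂ and g(m) = m^n q^m.  Expanding both power sums, the
-- k-th summand of the left-hand side is a double sum over the block
-- (i, j) ∈ [0, b) × [0, a):
--
--   C(n,k) a^k S_{k,q^a}(b-1) S_{n-k,q}(a-1)
--     = Σ_{i<b} Σ_{j<a} C(n,k) (a i)^k j^(n-k) q^(a i + j).
--
-- Moving the sum over k inside and applying the binomial theorem gives
-- Σ_{i<b} Σ_{j<a} g(a i + j), and since m = a i + j runs exactly once over
-- [0, a b) this is S_{n,q}(a b - 1).  The result is symmetric in a and b,
-- which is the corollary.

open import Defs
open import Level using (Level)
open import Data.Nat using (ℕ; _≤_; _∸_; zero; suc; s≤s; z≤n)
open import Data.Nat.Combinatorics using (_C_)
open import Relation.Nullary using (¬_)
open import Algebra.Bundles using (CommutativeRing)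
import Data.Nat as ℕ
import Data.Nat.Properties as ℕP
open import Data.Fin using (Fin; suc; toℕ; _↑ˡ_; _↑ʳ_; combine; inject₁; fromℕ)
open import Data.Fin.Properties using (toℕ-combine; toℕ-inject₁; toℕ-fromℕ)
open import Data.Vec.Functional using (Vector)
open import Function using (_∘_)
import Relation.Binary.PropositionalEquality as ≡
import Algebra.Solver.CommutativeMonoid as CommutativeMonoidSolver
import Algebra.Properties.Semiring.Sum as SemiringSum
import Algebra.Properties.Semiring.Exp as SemiringExp
import Algebra.Properties.Semiring.Mult as SemiringMult
import Algebra.Properties.CommutativeSemiring.Exp as CommutativeSemiringExp
import Algebra.Properties.CommutativeSemiring.Binomial as Binomial

module PowerSums {c ℓ : Level} (R : CommutativeRing c ℓ) where
  open CommutativeRing R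
  open QPower R
  open SemiringSum semiring
  open SemiringExp semiring using (^-congˡ; ^-homo-*; ^-assocʳ)
  open SemiringMult semiring using (×-assoc-*; ×-congʳ; ×-homo-+; ×1-homo-*)
  open CommutativeSemiringExp commutativeSemiring using (^-distrib-*)
  open import Relation.Binary.Reasoning.Setoid setoid

  sum-↑ : ∀ m n (f : Vector Carrier (m ℕ.+ n)) →
          sum f ≈ ∑[ i < m ] f (i ↑ˡ n) + ∑[ j < n ] f (m ↑ʳ j)
  sum-↑ zero    n f = sym (+-identityˡ _)
  sum-↑ (suc m) n f = trans (+-congˡ (sum-↑ m n (f ∘ suc))) (sym (+-assoc _ _ _))

  sum-combine : ∀ m n (f : Vector Carrier (m ℕ.* n)) →
                sum f ≈ ∑[ i < m ] ∑[ j < n ] f (combine i j)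
  sum-combine zero    n f = refl
  sum-combine (suc m) n f =
    trans (sum-↑ n (m ℕ.* n) f) (+-congˡ (sum-combine m n (f ∘ (n ↑ʳ_))))

  sumTo-∑ : ∀ N (f : ℕ → Carrier) → sumTo N f ≈ ∑[ i ≤ N ] f (toℕ i)
  sumTo-∑ zero    f = sym (+-identityʳ _)
  sumTo-∑ (suc N) f = begin
    sumTo N f + f (suc N)
      ≈⟨ +-congʳ (sumTo-∑ N f) ⟩
    ∑[ i ≤ N ] f (toℕ i) + f (suc N)
      ≈⟨ +-cong (sum-cong-≋ {suc N} (λ i → reflexive (≡.cong f (≡.sym (toℕ-inject₁ i)))))
                (reflexive (≡.cong f (≡.sym (toℕ-fromℕ (suc N))))) ⟩
    ∑[ i ≤ N ] f (toℕ (inject₁ i)) + f (toℕ (fromℕ (suc N)))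
      ≈⟨ sum-init-last (f ∘ toℕ) ⟨
    ∑[ i ≤ suc N ] f (toℕ i)
      ∎

  sum-*-sum : ∀ {m n} x (f : Vector Carrier m) (g : Vector Carrier n) y →
              x * sum f * sum g * y ≈ ∑[ i < m ] ∑[ j < n ] (x * f i * g j * y)
  sum-*-sum {m} {n} x f g y = begin
    x * sum f * sum g * y
      ≈⟨ *-congʳ (*-congʳ (*-distribˡ-sum x f)) ⟩
    ∑[ i < m ] (x * f i) * sum g * y
      ≈⟨ *-congʳ (*-distribʳ-sum (sum g) (λ i → x * f i)) ⟩
    ∑[ i < m ] (x * f i * sum g) * y
      ≈⟨ *-distribʳ-sum y (λ i → x * f i * sum g) ⟩
    ∑[ i < m ] (x * f i * sum g * y)
      ≈⟨ sum-cong-≋ {m} (λ i → trans (*-congʳ (*-distribˡ-sum (x * f i) g))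
                                 (*-distribʳ-sum y (λ j → x * f i * g j))) ⟩
    ∑[ i < m ] ∑[ j < n ] (x * f i * g j * y)
      ∎

  ⟦⟧-* : ∀ m x → ⟦ m ⟧ * x ≈ m × x
  ⟦⟧-* m x = trans (×-assoc-* m 1# x) (×-congʳ m (*-identityˡ x))

  ⟦⟧-linear : ∀ a i j → ⟦ a ℕ.* i ℕ.+ j ⟧ ≈ ⟦ a ⟧ * ⟦ i ⟧ + ⟦ j ⟧
  ⟦⟧-linear a i j = trans (×-homo-+ 1# (a ℕ.* i) j) (+-congʳ (×1-homo-* a i))

  binomial : ∀ n x y → (x + y) ^ n ≈ ∑[ k ≤ n ] (⟦ n C toℕ k ⟧ * (x ^ toℕ k * y ^ (n ∸ toℕ k)))
  binomial n x y = trans (Binomial.theorem commutativeSemiring n x y)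
                         (sum-cong-≋ {suc n} (λ k → sym (⟦⟧-* (n C toℕ k) (x ^ toℕ k * y ^ (n ∸ toℕ k)))))

  term : Carrier → (a n k i j : ℕ) → Carrier
  term q a n k i j = ⟦ n C k ⟧ * ((⟦ a ⟧ * ⟦ i ⟧) ^ k * ⟦ j ⟧ ^ (n ∸ k)) * q ^ (a ℕ.* i ℕ.+ j)

  regroup : ∀ q a n k i j →
    ⟦ n C k ⟧ * (⟦ i ⟧ ^ k * (q ^ a) ^ i) * (⟦ j ⟧ ^ (n ∸ k) * q ^ j) * ⟦ a ⟧ ^ k
    ≈ term q a n k i j
  regroup q a n k i j = begin
    B * (I * Qai) * (J * Qj) * A
      ≈⟨ solve 6 (λ B I Qai J Qj A → ((B ⊕ (I ⊕ Qai)) ⊕ (J ⊕ Qj)) ⊕ A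
                                   ⊜ (B ⊕ ((A ⊕ I) ⊕ J)) ⊕ (Qai ⊕ Qj))
               refl B I Qai J Qj A ⟩
    B * ((A * I) * J) * (Qai * Qj)
      ≈⟨ *-congˡ (*-congʳ (^-assocʳ q a i)) ⟩
    B * ((A * I) * J) * (q ^ (a ℕ.* i) * Qj)
      ≈⟨ *-cong (*-congˡ (*-congʳ (^-distrib-* ⟦ a ⟧ ⟦ i ⟧ k))) (^-homo-* q (a ℕ.* i) j) ⟨
    term q a n k i j
      ∎
    where
    open CommutativeMonoidSolver *-commutativeMonoid using (solve; _⊕_; _⊜_)
    B I Qai J Qj A : Carrier
    B = ⟦ n C k ⟧
    I = ⟦ i ⟧ ^ k
    Qai = (q ^ a) ^ i
    J = ⟦ j ⟧ ^ (n ∸ k)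
    Qj = q ^ j
    A = ⟦ a ⟧ ^ k

  summand-expansion : ∀ q a N M n k →
    ⟦ n C k ⟧ * S k (q ^ a) N * S (n ∸ k) q M * ⟦ a ⟧ ^ k
    ≈ ∑[ i ≤ N ] ∑[ j ≤ M ] term q a n k (toℕ i) (toℕ j)
  summand-expansion q a N M n k = begin
    ⟦ n C k ⟧ * S k (q ^ a) N * S (n ∸ k) q M * ⟦ a ⟧ ^ k
      ≈⟨ *-congʳ (*-cong (*-congˡ (sumTo-∑ N _)) (sumTo-∑ M _)) ⟩
    ⟦ n C k ⟧ * sum X * sum Y * ⟦ a ⟧ ^ k
      ≈⟨ sum-*-sum ⟦ n C k ⟧ X Y (⟦ a ⟧ ^ k) ⟩
    ∑[ i ≤ N ] ∑[ j ≤ M ] (⟦ n C k ⟧ * X i * Y j * ⟦ a ⟧ ^ k)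
      ≈⟨ sum-cong-≋ {suc N} (λ i → sum-cong-≋ {suc M} (λ j → regroup q a n k (toℕ i) (toℕ j))) ⟩
    ∑[ i ≤ N ] ∑[ j ≤ M ] term q a n k (toℕ i) (toℕ j)
      ∎
    where
    X : Vector Carrier (suc N)
    X i = ⟦ toℕ i ⟧ ^ k * (q ^ a) ^ toℕ i
    Y : Vector Carrier (suc M)
    Y j = ⟦ toℕ j ⟧ ^ (n ∸ k) * q ^ toℕ j

  binomial-block : ∀ q a n i j →
    ∑[ k ≤ n ] term q a n (toℕ k) i j ≈ ⟦ a ℕ.* i ℕ.+ j ⟧ ^ n * q ^ (a ℕ.* i ℕ.+ j)
  binomial-block q a n i j = begin
    ∑[ k ≤ n ] term q a n (toℕ k) i j
      ≈⟨ *-distribʳ-sum (q ^ m) binomialTerm ⟨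
    ∑[ k ≤ n ] binomialTerm k * q ^ m
      ≈⟨ *-congʳ (binomial n (⟦ a ⟧ * ⟦ i ⟧) ⟦ j ⟧) ⟨
    (⟦ a ⟧ * ⟦ i ⟧ + ⟦ j ⟧) ^ n * q ^ m
      ≈⟨ *-congʳ (^-congˡ n (⟦⟧-linear a i j)) ⟨
    ⟦ m ⟧ ^ n * q ^ m
      ∎
    where
    m : ℕ
    m = a ℕ.* i ℕ.+ j
    binomialTerm : Vector Carrier (suc n)
    binomialTerm k = ⟦ n C toℕ k ⟧ * ((⟦ a ⟧ * ⟦ i ⟧) ^ toℕ k * ⟦ j ⟧ ^ (n ∸ toℕ k))

  distribution : ∀ q w₁ w₂ n → 1 ≤ w₁ → 1 ≤ w₂ →
    sumTo n (λ k → ⟦ n C k ⟧ * S k (q ^ w₁) (w₂ ∸ 1) * S (n ∸ k) q (w₁ ∸ 1) * (⟦ w₁ ⟧ ^ k))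
    ≈ S n q (w₂ ℕ.* w₁ ∸ 1)
  distribution q a@(suc a′) b@(suc b′) n (s≤s z≤n) (s≤s z≤n) = begin
    sumTo n (λ k → ⟦ n C k ⟧ * S k (q ^ a) b′ * S (n ∸ k) q a′ * (⟦ a ⟧ ^ k))
      ≈⟨ sumTo-∑ n _ ⟩
    ∑[ k ≤ n ] (⟦ n C toℕ k ⟧ * S (toℕ k) (q ^ a) b′ * S (n ∸ toℕ k) q a′ * (⟦ a ⟧ ^ toℕ k))
      ≈⟨ sum-cong-≋ {suc n} (λ k → summand-expansion q a b′ a′ n (toℕ k)) ⟩
    ∑[ k ≤ n ] ∑[ i < b ] ∑[ j < a ] t k i j
      ≈⟨ ∑-comm (λ k i → ∑[ j < a ] t k i j) ⟩
    ∑[ i < b ] ∑[ k ≤ n ] ∑[ j < a ] t k i j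
      ≈⟨ sum-cong-≋ {b} (λ i → ∑-comm (λ k j → t k i j)) ⟩
    ∑[ i < b ] ∑[ j < a ] ∑[ k ≤ n ] t k i j
      ≈⟨ sum-cong-≋ {b} (λ i → sum-cong-≋ {a} (λ j → binomial-block q a n (toℕ i) (toℕ j))) ⟩
    ∑[ i < b ] ∑[ j < a ] g (a ℕ.* toℕ i ℕ.+ toℕ j)
      ≈⟨ sum-cong-≋ {b} (λ i → sum-cong-≋ {a} (λ j → reflexive (≡.cong g (≡.sym (toℕ-combine i j))))) ⟩
    ∑[ i < b ] ∑[ j < a ] g (toℕ (combine i j))
      ≈⟨ sum-combine b a (g ∘ toℕ) ⟨
    ∑[ m < b ℕ.* a ] g (toℕ m)
      ≈⟨ sumTo-∑ (b ℕ.* a ∸ 1) g ⟨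
    S n q (b ℕ.* a ∸ 1)
      ∎
    where
    g : ℕ → Carrier
    g m = ⟦ m ⟧ ^ n * q ^ m
    t : Fin (suc n) → Fin b → Fin a → Carrier
    t k i j = term q a n (toℕ k) (toℕ i) (toℕ j)

corollary4p18 : {c ℓ : Level} (R : CommutativeRing c ℓ) →
    let open CommutativeRing R
        open QPower R
    in (q : Carrier) → ¬ (q ≈ 1#) →
       (w₁ w₂ n : ℕ) → 1 ≤ w₁ → 1 ≤ w₂ →
       sumTo n (λ k → ⟦ n C k ⟧ * S k (q ^ w₁) (w₂ ∸ 1) * S (n ∸ k) q (w₁ ∸ 1) * (⟦ w₁ ⟧ ^ k))
       ≈ sumTo n (λ k → ⟦ n C k ⟧ * S k (q ^ w₂) (w₁ ∸ 1) * S (n ∸ k) q (w₂ ∸ 1) * (⟦ w₂ ⟧ ^ k))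
corollary4p18 R q _ w₁ w₂ n 1≤w₁ 1≤w₂ =
  trans (distribution q w₁ w₂ n 1≤w₁ 1≤w₂)
        (trans (reflexive (≡.cong (λ m → S n q (m ∸ 1)) (ℕP.*-comm w₂ w₁)))
               (sym (distribution q w₂ w₁ n 1≤w₂ 1≤w₁)))
  where
  open CommutativeRing R
  open QPower R
  open PowerSums R
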